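{- For every graph $G$ with minimum degree $\delta(G)\ge 2$, $\gamma_{t\times 2}(G)\le 2\gamma_{\times 2}(G)-1$.
   Context: $G=(V,E)$ finite simple graph; $N(v)$, $N[v]$ open and closed neighborhoods. $\gamma_{\times 2}(G)$ is the minimum size of a set $D\subseteq V$ with $|N[v]\cap D|\ge 2$ for every $v\in V$. $\gamma_{t\times 2}(G)$ is the minimum size of a set $D\subseteq V$ with $|N(v)\cap D|\ge 2$ for every $v\in V$. -}

module Defs where

open import Data.Nat using (ℕ; _≤_; _∸_; _*_)
open import Data.Bool using (Bool; true; false; _∨_)
open import Data.Fin using (Fin; _≟_)
open import Data.Fin.Subset using (Subset; _∩_; ∣_∣; _∈_)
open import Data.Vec using (tabulate)
open import Data.Product using (Σ; _×_)
open import Relation.Binary.PropositionalEquality using (_≡_; _≢_)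
open import Relation.Nullary.Decidable using (⌊_⌋)

record Graph (n : ℕ) : Set where
  field
    adj     : Fin n → Fin n → Bool
    sym     : ∀ u v → adj u v ≡ adj v u
    irrefl  : ∀ v → adj v v ≡ false

open Graph public

N : ∀ {n} → Graph n → Fin n → Subset n
N G v = tabulate (λ u → adj G v u)

N[_] : ∀ {n} → Graph n → Fin n → Subset n
N[_] G v = tabulate (λ u → adj G v u ∨ ⌊ u ≟ v ⌋)

deg : ∀ {n} → Graph n → Fin n → ℕ
deg G v = ∣ N G v ∣

minDeg≥ : ∀ {n} → Graph n → ℕ → Set
minDeg≥ G k = ∀ v → k ≤ deg G v

IsDoubleDom : ∀ {n} → Graph n → Subset n → Set
IsDoubleDom G D = ∀ v → 2 ≤ ∣ N[_] G v ∩ D ∣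

IsDoubleTotalDom : ∀ {n} → Graph n → Subset n → Set
IsDoubleTotalDom G D = ∀ v → 2 ≤ ∣ N G v ∩ D ∣

IsDoubleDomNumber : ∀ {n} → Graph n → ℕ → Set
IsDoubleDomNumber G k =
  Σ (Subset _) (λ D → IsDoubleDom G D × ∣ D ∣ ≡ k) ×
  (∀ D → IsDoubleDom G D → k ≤ ∣ D ∣)

IsDoubleTotalDomNumber : ∀ {n} → Graph n → ℕ → Set
IsDoubleTotalDomNumber G k =
  Σ (Subset _) (λ D → IsDoubleTotalDom G D × ∣ D ∣ ≡ k) ×
  (∀ D → IsDoubleTotalDom G D → k ≤ ∣ D ∣)

module Submission where

-- Call a vertex v doubly dominated by S if it has two neighbours in S.  A
-- double dominating set D is a total dominating set (every vertex has a
-- neighbour in D) which doubly dominates every vertex outside D.  With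
-- δ(G) ≥ 2, a total dominating set can be made to doubly dominate any single
-- vertex by adding one further vertex; repeating this for a "pending" set B
-- (`Repair.repair`) yields a double total dominating set of size ≤ ∣S∣ + ∣B∣.
-- Starting from D with pending set D − u costs ∣D∣ + (∣D∣ − 1) when D already
-- doubly dominates u; otherwise one added neighbour w ∉ D of u also repairs a
-- second member x of D adjacent to w, and the cost is (∣D∣ + 1) + (∣D∣ − 2)
-- (`FromDoubleDom.fromMember`).

open import Defs hiding (sym)
open import Data.Nat using (_≤_; _<_; _∸_; _*_; _+_; suc; zero; z≤n; s≤s; s≤s⁻¹)
open import Data.Nat.Properties
  using (≤-trans; ≤-reflexive; n≤1+n; m≤m+n; ≰⇒>; _≤?_; +-suc; +-identityʳ; +-monoˡ-≤; +-monoʳ-≤; ∸-monoˡ-≤; module ≤-Reasoning)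
open import Data.Nat.Induction using (<-wellFounded)
open import Induction.WellFounded using (Acc; acc)
open import Data.Bool using (true; false; _∨_)
open import Data.Fin using (Fin; _≟_) renaming (zero to fzero)
open import Data.Fin.Subset using (Subset; _─_; _∩_; _∪_; ∣_∣; _∈_; _∉_; _⊆_; ⁅_⁆; _-_; Nonempty)
open import Data.Fin.Subset.Properties
open import Data.Vec using ([]; _∷_; there)
open import Data.Vec.Properties using ([]=⇒lookup; lookup⇒[]=; lookup∘tabulate)
open import Data.Product using (Σ; _×_; _,_; proj₁; proj₂)
open import Data.Sum using (inj₁; inj₂)
open import Relation.Nullary using (¬_; yes; no; contradiction)
open import Relation.Nullary.Decidable using (⌊_⌋)
open import Relation.Binary.PropositionalEquality using (_≡_; _≢_; refl; sym; trans; cong)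

x∈p─q⇒x∉q : ∀ {n} (p q : Subset n) {x} → x ∈ p ─ q → x ∉ q
x∈p─q⇒x∉q (_ ∷ p) (true  ∷ q) (there x∈) (there x∈q) = x∈p─q⇒x∉q p q x∈ x∈q
x∈p─q⇒x∉q (_ ∷ p) (false ∷ q) (there x∈) (there x∈q) = x∈p─q⇒x∉q p q x∈ x∈q

∣p∣≡∣p∩q∣+∣p─q∣ : ∀ {n} (p q : Subset n) → ∣ p ∣ ≡ ∣ p ∩ q ∣ + ∣ p ─ q ∣
∣p∣≡∣p∩q∣+∣p─q∣ []          []          = refl
∣p∣≡∣p∩q∣+∣p─q∣ (true  ∷ p) (true  ∷ q) = cong suc (∣p∣≡∣p∩q∣+∣p─q∣ p q)
∣p∣≡∣p∩q∣+∣p─q∣ (true  ∷ p) (false ∷ q) =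
  trans (cong suc (∣p∣≡∣p∩q∣+∣p─q∣ p q)) (sym (+-suc ∣ p ∩ q ∣ ∣ p ─ q ∣))
∣p∣≡∣p∩q∣+∣p─q∣ (false ∷ p) (true  ∷ q) = ∣p∣≡∣p∩q∣+∣p─q∣ p q
∣p∣≡∣p∩q∣+∣p─q∣ (false ∷ p) (false ∷ q) = ∣p∣≡∣p∩q∣+∣p─q∣ p q

∣p∣≤1+∣p-x∣ : ∀ {n} (p : Subset n) (x : Fin n) → ∣ p ∣ ≤ suc ∣ p - x ∣
∣p∣≤1+∣p-x∣ p x = begin
  ∣ p ∣                         ≡⟨ ∣p∣≡∣p∩q∣+∣p─q∣ p ⁅ x ⁆ ⟩
  ∣ p ∩ ⁅ x ⁆ ∣ + ∣ p - x ∣     ≤⟨ +-monoˡ-≤ ∣ p - x ∣ (∣p∩q∣≤∣q∣ p ⁅ x ⁆) ⟩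
  ∣ ⁅ x ⁆ ∣ + ∣ p - x ∣         ≡⟨ cong (_+ ∣ p - x ∣) (∣⁅x⁆∣≡1 x) ⟩
  suc ∣ p - x ∣                 ∎
  where open ≤-Reasoning

∣p∪⁅x⁆∣≤1+∣p∣ : ∀ {n} (p : Subset n) (x : Fin n) → ∣ p ∪ ⁅ x ⁆ ∣ ≤ suc ∣ p ∣
∣p∪⁅x⁆∣≤1+∣p∣ p x = ≤-trans (∣p∣≤1+∣p-x∣ (p ∪ ⁅ x ⁆) x) (s≤s (p⊆q⇒∣p∣≤∣q∣ [p∪⁅x⁆]-x⊆p))
  where
  [p∪⁅x⁆]-x⊆p : (p ∪ ⁅ x ⁆) - x ⊆ p
  [p∪⁅x⁆]-x⊆p {y} y∈ with x∈p∪q⁻ p ⁅ x ⁆ (p─q⊆p (p ∪ ⁅ x ⁆) ⁅ x ⁆ y∈)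
  ... | inj₁ y∈p  = y∈p
  ... | inj₂ y∈⁅x⁆ = contradiction y∈⁅x⁆ (x∈p─q⇒x∉q (p ∪ ⁅ x ⁆) ⁅ x ⁆ y∈)

1≤∣p∣⇒nonempty : ∀ {n} (p : Subset n) → 1 ≤ ∣ p ∣ → Nonempty p
1≤∣p∣⇒nonempty {n} p 1≤∣p∣ with nonempty? p
... | yes ne = ne
... | no ¬ne with ≤-trans 1≤∣p∣ (≤-reflexive (trans (cong ∣_∣ (Empty-unique ¬ne)) (∣⊥∣≡0 n)))
... | ()

2≤∣p∣⇒avoid : ∀ {n} (p : Subset n) → 2 ≤ ∣ p ∣ → ∀ u → Σ (Fin n) λ x → x ∈ p × x ≢ u
2≤∣p∣⇒avoid p 2≤∣p∣ u with 1≤∣p∣⇒nonempty (p - u) (s≤s⁻¹ (≤-trans 2≤∣p∣ (∣p∣≤1+∣p-x∣ p u)))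
... | x , x∈p-u = x , p─q⊆p p ⁅ u ⁆ x∈p-u , λ { refl → x∈p─q⇒x∉q p ⁅ u ⁆ x∈p-u (x∈⁅x⁆ u) }

escape : ∀ {n} (p q : Subset n) → 2 ≤ ∣ p ∣ → ¬ (2 ≤ ∣ p ∩ q ∣) → Σ (Fin n) λ x → x ∈ p × x ∉ q
escape p q 2≤∣p∣ ∣p∩q∣<2 with 1≤∣p∣⇒nonempty (p ─ q) 1≤∣p─q∣
  where
  1≤∣p─q∣ : 1 ≤ ∣ p ─ q ∣
  1≤∣p─q∣ = s≤s⁻¹ (begin
    2                          ≤⟨ 2≤∣p∣ ⟩
    ∣ p ∣                      ≡⟨ ∣p∣≡∣p∩q∣+∣p─q∣ p q ⟩
    ∣ p ∩ q ∣ + ∣ p ─ q ∣      ≤⟨ +-monoˡ-≤ ∣ p ─ q ∣ (s≤s⁻¹ (≰⇒> ∣p∩q∣<2)) ⟩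
    1 + ∣ p ─ q ∣              ∎)
    where open ≤-Reasoning
... | x , x∈p─q = x , p─q⊆p p q x∈p─q , x∈p─q⇒x∉q p q x∈p─q

x∉p-y⇒x∉p : ∀ {n} {p : Subset n} {x y} → x ∉ p - y → x ≢ y → x ∉ p
x∉p-y⇒x∉p x∉p-y x≢y x∈p = x∉p-y (x∈p∧x≢y⇒x∈p-y x∈p x≢y)

a+b≤2k∸1 : ∀ {a b k} → a + suc b ≤ k + k → a + b ≤ 2 * k ∸ 1
a+b≤2k∸1 {a} {b} {k} le = begin
  a + b               ≡⟨ cong (_∸ 1) (sym (+-suc a b)) ⟩
  a + suc b ∸ 1       ≤⟨ ∸-monoˡ-≤ 1 le ⟩
  k + k ∸ 1           ≡⟨ cong (λ m → k + m ∸ 1) (sym (+-identityʳ k)) ⟩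
  2 * k ∸ 1           ∎
  where open ≤-Reasoning

adj⇒∈N : ∀ {n} (G : Graph n) {v u} → adj G v u ≡ true → u ∈ N G v
adj⇒∈N G {v} {u} vu = lookup⇒[]= u (N G v) (trans (lookup∘tabulate (adj G v) u) vu)

∈N⇒adj : ∀ {n} (G : Graph n) {v u} → u ∈ N G v → adj G v u ≡ true
∈N⇒adj G {v} {u} u∈N = trans (sym (lookup∘tabulate (adj G v) u)) ([]=⇒lookup u∈N)

N-sym : ∀ {n} (G : Graph n) {v u} → u ∈ N G v → v ∈ N G u
N-sym G {v} {u} u∈N = adj⇒∈N G (trans (Graph.sym G u v) (∈N⇒adj G u∈N))

N[]⇒N : ∀ {n} (G : Graph n) {v u} → u ∈ N[ G ] v → u ≢ v → u ∈ N G v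
N[]⇒N G {v} {u} u∈N[] u≢v =
  adj⇒∈N G (adjacent (trans (sym (lookup∘tabulate _ u)) ([]=⇒lookup u∈N[])))
  where
  adjacent : adj G v u ∨ ⌊ u ≟ v ⌋ ≡ true → adj G v u ≡ true
  adjacent vu∨u≡v with u ≟ v | adj G v u
  ... | yes u≡v | _    = contradiction u≡v u≢v
  ... | no _    | true = refl
  adjacent () | no _ | false

module _ {n} (G : Graph n) where

  DoublyDominates : Subset n → Fin n → Set
  DoublyDominates S v = 2 ≤ ∣ N G v ∩ S ∣

  DoublyDominatesOutside : Subset n → Subset n → Set
  DoublyDominatesOutside S B = ∀ v → v ∉ B → DoublyDominates S v

  IsTotalDom : Subset n → Set
  IsTotalDom S = ∀ v → 1 ≤ ∣ N G v ∩ S ∣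

  ∣N∩∣-mono : ∀ {S S'} v → S ⊆ S' → ∣ N G v ∩ S ∣ ≤ ∣ N G v ∩ S' ∣
  ∣N∩∣-mono {S} v S⊆S' = p⊆q⇒∣p∣≤∣q∣ λ {x} x∈ →
    let (x∈N , x∈S) = x∈p∩q⁻ (N G v) S x∈ in x∈p∩q⁺ (x∈N , S⊆S' x∈S)

  -- A vertex with one neighbour in S is doubly dominated once a further
  -- neighbour w ∉ S is added: N(v) ∩ (S ∪ {w}) minus w still contains N(v) ∩ S.
  addNeighbour : ∀ {S v w} → 1 ≤ ∣ N G v ∩ S ∣ → w ∈ N G v → w ∉ S →
                 DoublyDominates (S ∪ ⁅ w ⁆) v
  addNeighbour {S} {v} {w} 1≤ w∈N w∉S =
    ≤-trans (s≤s (≤-trans 1≤ (p⊆q⇒∣p∣≤∣q∣ N∩S⊆rest))) (x∈p⇒∣p-x∣<∣p∣ w∈new)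
    where
    new : Subset n
    new = N G v ∩ (S ∪ ⁅ w ⁆)
    w∈new : w ∈ new
    w∈new = x∈p∩q⁺ (w∈N , q⊆p∪q S ⁅ w ⁆ (x∈⁅x⁆ w))
    N∩S⊆rest : N G v ∩ S ⊆ new - w
    N∩S⊆rest {x} x∈ with x∈p∩q⁻ (N G v) S x∈
    ... | x∈N , x∈S = x∈p∧x≢y⇒x∈p-y (x∈p∩q⁺ (x∈N , p⊆p∪q ⁅ w ⁆ x∈S))
                                      λ { refl → w∉S x∈S }

  -- In a double dominating set D every vertex has a neighbour in D: of the
  -- two members of N[v] ∩ D at most one is v itself.
  doubleDom⇒totalDom : ∀ {D} → IsDoubleDom G D → IsTotalDom D
  doubleDom⇒totalDom {D} dd v =
    s≤s⁻¹ (≤-trans (dd v) (≤-trans (∣p∣≤1+∣p-x∣ (N[ G ] v ∩ D) v)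
                                  (s≤s (p⊆q⇒∣p∣≤∣q∣ N[]∩D-v⊆N∩D))))
    where
    N[]∩D-v⊆N∩D : (N[ G ] v ∩ D) - v ⊆ N G v ∩ D
    N[]∩D-v⊆N∩D {x} x∈ with x∈p∩q⁻ (N[ G ] v) D (p─q⊆p _ ⁅ v ⁆ x∈)
    ... | x∈N[] , x∈D = x∈p∩q⁺ (N[]⇒N G x∈N[] (x∉⁅y⁆⇒x≢y (x∈p─q⇒x∉q _ ⁅ v ⁆ x∈)) , x∈D)

  doubleDom⇒dominatesOutside : ∀ {D} → IsDoubleDom G D → ∀ v → v ∉ D → DoublyDominates D v
  doubleDom⇒dominatesOutside {D} dd v v∉D = ≤-trans (dd v) (p⊆q⇒∣p∣≤∣q∣ N[]∩D⊆N∩D)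
    where
    N[]∩D⊆N∩D : N[ G ] v ∩ D ⊆ N G v ∩ D
    N[]∩D⊆N∩D {x} x∈ with x∈p∩q⁻ (N[ G ] v) D x∈
    ... | x∈N[] , x∈D = x∈p∩q⁺ (N[]⇒N G x∈N[] (λ { refl → v∉D x∈D }) , x∈D)

module Repair {n} (G : Graph n) (δ≥2 : minDeg≥ G 2) where

  -- With minimum degree two, a total dominating set S can be made to doubly
  -- dominate any one vertex b by adding at most one vertex: b has a neighbour
  -- in S and, if it has no second one there, a neighbour w outside S.
  dominateTwice : ∀ {S} → IsTotalDom G S → ∀ b →
               Σ (Subset n) λ S' → S ⊆ S' × ∣ S' ∣ ≤ suc ∣ S ∣ × DoublyDominates G S' b
  dominateTwice {S} td b with 2 ≤? ∣ N G b ∩ S ∣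
  ... | yes b-done   = S , (λ x∈S → x∈S) , n≤1+n ∣ S ∣ , b-done
  ... | no b-short with escape (N G b) S (δ≥2 b) b-short
  ... | w , w∈N , w∉S = S ∪ ⁅ w ⁆ , p⊆p∪q ⁅ w ⁆ , ∣p∪⁅x⁆∣≤1+∣p∣ S w , addNeighbour G (td b) w∈N w∉S

  discharge : ∀ {S B} b → IsTotalDom G S → DoublyDominatesOutside G S B →
              Σ (Subset n) λ S' → IsTotalDom G S' × DoublyDominatesOutside G S' (B - b) × ∣ S' ∣ ≤ suc ∣ S ∣
  discharge {S} {B} b td out with dominateTwice td b
  ... | S' , S⊆S' , ∣S'∣≤ , b-done = S' , td' , out' , ∣S'∣≤
    where
    td' : IsTotalDom G S'
    td' v = ≤-trans (td v) (∣N∩∣-mono G v S⊆S')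
    out' : DoublyDominatesOutside G S' (B - b)
    out' v v∉B-b with v ≟ b
    ... | yes refl = b-done
    ... | no v≢b   = ≤-trans (out v (x∉p-y⇒x∉p v∉B-b v≢b)) (∣N∩∣-mono G v S⊆S')

  repair : ∀ {S} B → Acc _<_ ∣ B ∣ → IsTotalDom G S → DoublyDominatesOutside G S B →
           Σ (Subset n) λ D' → IsDoubleTotalDom G D' × ∣ D' ∣ ≤ ∣ S ∣ + ∣ B ∣
  repair {S} B (acc smaller) td out with nonempty? B
  ... | no B-empty = S , (λ v → out v λ v∈B → B-empty (v , v∈B)) , m≤m+n ∣ S ∣ ∣ B ∣
  ... | yes (b , b∈B) =
    let (S' , td' , out' , ∣S'∣≤) = discharge b td out
        (D' , dtd , ∣D'∣≤)       = repair (B - b) (smaller ∣B-b∣<∣B∣) td' out'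
    in  D' , dtd , cost D' S' ∣D'∣≤ ∣S'∣≤
    where
    ∣B-b∣<∣B∣ : ∣ B - b ∣ < ∣ B ∣
    ∣B-b∣<∣B∣ = x∈p⇒∣p-x∣<∣p∣ b∈B
    cost : ∀ D' S' → ∣ D' ∣ ≤ ∣ S' ∣ + ∣ B - b ∣ → ∣ S' ∣ ≤ suc ∣ S ∣ → ∣ D' ∣ ≤ ∣ S ∣ + ∣ B ∣
    cost D' S' ∣D'∣≤ ∣S'∣≤ = begin
      ∣ D' ∣                 ≤⟨ ∣D'∣≤ ⟩
      ∣ S' ∣ + ∣ B - b ∣     ≤⟨ +-monoˡ-≤ ∣ B - b ∣ ∣S'∣≤ ⟩
      suc ∣ S ∣ + ∣ B - b ∣  ≡⟨ sym (+-suc ∣ S ∣ ∣ B - b ∣) ⟩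
      ∣ S ∣ + suc ∣ B - b ∣  ≤⟨ +-monoʳ-≤ ∣ S ∣ ∣B-b∣<∣B∣ ⟩
      ∣ S ∣ + ∣ B ∣          ∎
      where open ≤-Reasoning

module FromDoubleDom {n} (G : Graph n) (δ≥2 : minDeg≥ G 2) {D} (dd : IsDoubleDom G D) where
  open Repair G δ≥2

  D-totalDom : IsTotalDom G D
  D-totalDom = doubleDom⇒totalDom G dd

  D-outside : ∀ v → v ∉ D → DoublyDominates G D v
  D-outside = doubleDom⇒dominatesOutside G dd

  withinBudget : ∀ {S} B → IsTotalDom G S → DoublyDominatesOutside G S B →
                 ∣ S ∣ + suc ∣ B ∣ ≤ ∣ D ∣ + ∣ D ∣ →
                 Σ (Subset n) λ D' → IsDoubleTotalDom G D' × ∣ D' ∣ ≤ 2 * ∣ D ∣ ∸ 1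
  withinBudget B td out budget =
    let (D' , dtd , ∣D'∣≤) = repair B (<-wellFounded ∣ B ∣) td out
    in  D' , dtd , ≤-trans ∣D'∣≤ (a+b≤2k∸1 {k = ∣ D ∣} budget)

  -- Given u ∈ D: if D doubly dominates u, only D - u is pending.  Otherwise u
  -- has a neighbour w ∉ D, and w has a neighbour x ∈ D other than u; adding w
  -- doubly dominates both u and x, leaving (D - u) - x pending at the cost of
  -- one vertex.
  fromMember : ∀ {u} → u ∈ D →
               Σ (Subset n) λ D' → IsDoubleTotalDom G D' × ∣ D' ∣ ≤ 2 * ∣ D ∣ ∸ 1
  fromMember {u} u∈D with 2 ≤? ∣ N G u ∩ D ∣
  ... | yes u-done = withinBudget (D - u) D-totalDom out (+-monoʳ-≤ ∣ D ∣ (x∈p⇒∣p-x∣<∣p∣ u∈D))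
    where
    out : DoublyDominatesOutside G D (D - u)
    out v v∉D-u with v ≟ u
    ... | yes refl = u-done
    ... | no v≢u   = D-outside v (x∉p-y⇒x∉p v∉D-u v≢u)
  ... | no u-short with escape (N G u) D (δ≥2 u) u-short
  ... | w , w∈Nu , w∉D with 2≤∣p∣⇒avoid (N G w ∩ D) (D-outside w w∉D) u
  ... | x , x∈Nw∩D , x≢u = withinBudget ((D - u) - x) td out budget
    where
    S : Subset n
    S = D ∪ ⁅ w ⁆
    x∈D-u : x ∈ D - u
    x∈D-u = x∈p∧x≢y⇒x∈p-y (proj₂ (x∈p∩q⁻ (N G w) D x∈Nw∩D)) x≢u
    td : IsTotalDom G S
    td v = ≤-trans (D-totalDom v) (∣N∩∣-mono G v (p⊆p∪q ⁅ w ⁆))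
    out : DoublyDominatesOutside G S ((D - u) - x)
    out v v∉B with v ≟ u | v ≟ x
    ... | yes refl | _        = addNeighbour G (D-totalDom u) w∈Nu w∉D
    ... | no _     | yes refl = addNeighbour G (D-totalDom x)
                                  (N-sym G (proj₁ (x∈p∩q⁻ (N G w) D x∈Nw∩D))) w∉D
    ... | no v≢u   | no v≢x   = ≤-trans (D-outside v (x∉p-y⇒x∉p (x∉p-y⇒x∉p v∉B v≢x) v≢u))
                                         (∣N∩∣-mono G v (p⊆p∪q ⁅ w ⁆))
    budget : ∣ S ∣ + suc ∣ (D - u) - x ∣ ≤ ∣ D ∣ + ∣ D ∣
    budget = begin
      ∣ S ∣ + suc ∣ (D - u) - x ∣           ≤⟨ +-monoˡ-≤ _ (∣p∪⁅x⁆∣≤1+∣p∣ D w) ⟩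
      suc ∣ D ∣ + suc ∣ (D - u) - x ∣       ≡⟨ sym (+-suc ∣ D ∣ _) ⟩
      ∣ D ∣ + suc (suc ∣ (D - u) - x ∣)     ≤⟨ +-monoʳ-≤ ∣ D ∣ (s≤s (x∈p⇒∣p-x∣<∣p∣ x∈D-u)) ⟩
      ∣ D ∣ + suc ∣ D - u ∣                 ≤⟨ +-monoʳ-≤ ∣ D ∣ (x∈p⇒∣p-x∣<∣p∣ u∈D) ⟩
      ∣ D ∣ + ∣ D ∣                         ∎
      where open ≤-Reasoning

-- Theorem: if δ(G) ≥ 2, every double dominating set D yields a double total
-- dominating set of size at most 2∣D∣ − 1.  On the empty graph take the empty
-- set; otherwise D is nonempty because it double dominates a vertex.
doubleTotalFromDouble : ∀ {n} (G : Graph n) → minDeg≥ G 2 → ∀ D → IsDoubleDom G D →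
  Σ (Subset n) λ D' → IsDoubleTotalDom G D' × ∣ D' ∣ ≤ 2 * ∣ D ∣ ∸ 1
doubleTotalFromDouble {zero}  G δ≥2 [] dd = [] , (λ ()) , z≤n
doubleTotalFromDouble {suc n} G δ≥2 D  dd
  with 1≤∣p∣⇒nonempty (N[ G ] fzero ∩ D) (≤-trans (s≤s z≤n) (dd fzero))
... | u , u∈ = FromDoubleDom.fromMember G δ≥2 dd (proj₂ (x∈p∩q⁻ (N[ G ] fzero) D u∈))

mainTheorem17 : ∀ {n} (G : Graph n) → minDeg≥ G 2 →
    ∀ k t → IsDoubleDomNumber G k → IsDoubleTotalDomNumber G t →
    t ≤ 2 * k ∸ 1
mainTheorem17 G δ≥2 k t ((D , dd , refl) , _) (_ , t-minimal) =
  let (D' , dtd , ∣D'∣≤) = doubleTotalFromDouble G δ≥2 D dd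
  in  ≤-trans (t-minimal D' dtd) ∣D'∣≤
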